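{- Let $n,m$ be positive integers and let $A=[a_{ij}]$ be an $n\times m$ binary matrix that is semi-canonical. Then there exist integers $i,j$ with $0\le i\le n$, $0\le j\le m$ such that $a_{11}=a_{12}=\dots=a_{1j}=0$ and $a_{1,j+1}=a_{1,j+2}=\dots=a_{1m}=1$, and $a_{11}=a_{21}=\dots=a_{i1}=0$ and $a_{i+1,1}=a_{i+2,1}=\dots=a_{n1}=1$. (That is, the first row consists of a block of $0$'s followed by a block of $1$'s, and likewise the first column.)
   Context: A binary matrix is a matrix with entries in $\{0,1\}$. For an $n\times m$ binary matrix $A=[a_{ij}]$, let $r(A)=\langle x_1,\dots,x_n\rangle$ where $x_i$ is the natural number whose binary representation is $a_{i1}a_{i2}\cdots a_{im}$ (so $a_{i1}$ is the most significant bit), and let $c(A)=\langle y_1,\dots,y_m\rangle$ where $y_j$ is the natural number whose binary representation is $a_{1j}a_{2j}\cdots a_{nj}$ (so $a_{1j}$ is the most significant bit). The matrix $A$ is called semi-canonical if $x_1\le x_2\le\dots\le x_n$ and $y_1\le y_2\le\dots\le y_m$. -}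

module Defs where

open import Data.Bool using (Bool; true; false)
open import Data.Nat using (ℕ; zero; suc; _+_; _*_; _≤_; _<_)
open import Data.Fin using (Fin; toℕ)
open import Data.List using (List; []; _∷_; foldl)
open import Data.Vec.Functional using (toList)
open import Data.Product using (_×_)

BinMatrix : ℕ → ℕ → Set
BinMatrix n m = Fin n → Fin m → Bool

bitVal : Bool → ℕ
bitVal false = 0
bitVal true  = 1

-- natural number with binary representation b₁ b₂ … bₖ (b₁ most significant)
fromBits : List Bool → ℕ
fromBits = foldl (λ acc b → 2 * acc + bitVal b) 0

rowVal : ∀ {n m} → BinMatrix n m → Fin n → ℕ
rowVal {n} {m} A i = fromBits (toList {n = m} (A i))

colVal : ∀ {n m} → BinMatrix n m → Fin m → ℕ
colVal {n} {m} A j = fromBits (toList {n = n} (λ i → A i j))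

NonDecreasing : ∀ {k} → (Fin k → ℕ) → Set
NonDecreasing {k} f = ∀ (a b : Fin k) → toℕ a ≤ toℕ b → f a ≤ f b

SemiCanonical : ∀ {n m} → BinMatrix n m → Set
SemiCanonical A = NonDecreasing (rowVal A) × NonDecreasing (colVal A)

module Submission where

-- The first bit of a fixed-width binary numeral dominates all the others: a numeral
-- starting with 1 exceeds every numeral of the same width starting with 0.  Hence a
-- non-decreasing sequence of such numerals has non-decreasing leading bits.  The columns
-- are non-decreasing and their leading bits form the first row, so the first row is
-- 0…01…1; symmetrically the rows give the first column.

open import Defs
open import Data.Bool using (Bool; true; false)
open import Data.Nat using (ℕ; zero; suc; _+_; _*_; _^_; _≤_; _<_; z≤n; s≤s)
open import Data.Nat.Properties
  using (module ≤-Reasoning; <⇒≱; +-monoʳ-<; +-monoˡ-≤; *-monoˡ-≤; m≤m+n; *-identityʳ; +-identityʳ)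
open import Data.Nat.Tactic.RingSolver using (solve-∀)
open import Data.Fin using (Fin; toℕ; zero; suc)
open import Data.List using (List; []; _∷_; foldl; length)
open import Data.List.Properties using (length-tabulate)
open import Data.Vec.Functional using (toList)
open import Data.Product using (_×_; Σ; _,_; proj₁; proj₂)
open import Data.Empty using (⊥-elim)
open import Relation.Binary.PropositionalEquality using (_≡_; refl; sym; trans; cong; module ≡-Reasoning)

bitStep : ℕ → Bool → ℕ
bitStep acc b = 2 * acc + bitVal b

foldl-bitStep : ∀ (bs : List Bool) acc →
  foldl bitStep acc bs ≡ acc * 2 ^ length bs + fromBits bs
foldl-bitStep []       acc = sym (trans (cong (_+ 0) (*-identityʳ acc)) (+-identityʳ acc))
foldl-bitStep (b ∷ bs) acc = begin
    foldl bitStep (bitStep acc b) bs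
  ≡⟨ foldl-bitStep bs (bitStep acc b) ⟩
    (2 * acc + bitVal b) * p + fromBits bs
  ≡⟨ distrib acc (bitVal b) p (fromBits bs) ⟩
    acc * (2 * p) + (bitVal b * p + fromBits bs)
  ≡⟨ cong (acc * (2 * p) +_) (sym (foldl-bitStep bs (bitVal b))) ⟩
    acc * (2 * p) + fromBits (b ∷ bs)
  ∎
  where
  open ≡-Reasoning
  p : ℕ
  p = 2 ^ length bs
  distrib : ∀ a v q r → (2 * a + v) * q + r ≡ a * (2 * q) + (v * q + r)
  distrib = solve-∀

fromBits-∷ : ∀ b (bs : List Bool) → fromBits (b ∷ bs) ≡ bitVal b * 2 ^ length bs + fromBits bs
fromBits-∷ b bs = foldl-bitStep bs (bitVal b)

bitVal≤1 : ∀ b → bitVal b ≤ 1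
bitVal≤1 false = z≤n
bitVal≤1 true  = s≤s z≤n

fromBits<2^length : ∀ (bs : List Bool) → fromBits bs < 2 ^ length bs
fromBits<2^length []       = s≤s z≤n
fromBits<2^length (b ∷ bs) = begin-strict
    fromBits (b ∷ bs)
  ≡⟨ fromBits-∷ b bs ⟩
    bitVal b * p + fromBits bs
  <⟨ +-monoʳ-< (bitVal b * p) (fromBits<2^length bs) ⟩
    bitVal b * p + p
  ≤⟨ +-monoˡ-≤ p (*-monoˡ-≤ p (bitVal≤1 b)) ⟩
    1 * p + p
  ≡⟨ double p ⟩
    2 * p
  ∎
  where
  open ≤-Reasoning
  p : ℕ
  p = 2 ^ length bs
  double : ∀ q → 1 * q + q ≡ 2 * q
  double = solve-∀

fromBits-0∷<1∷ : ∀ (bs cs : List Bool) → length bs ≡ length cs →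
  fromBits (false ∷ cs) < fromBits (true ∷ bs)
fromBits-0∷<1∷ bs cs same = begin-strict
    fromBits cs
  <⟨ fromBits<2^length cs ⟩
    2 ^ length cs
  ≡⟨ cong (2 ^_) (sym same) ⟩
    2 ^ length bs
  ≤⟨ m≤m+n (2 ^ length bs) (fromBits bs) ⟩
    2 ^ length bs + fromBits bs
  ≡⟨ sym (trans (fromBits-∷ true bs) (cong (_+ fromBits bs) (+-identityʳ (2 ^ length bs)))) ⟩
    fromBits (true ∷ bs)
  ∎
  where
  open ≤-Reasoning

leadingBit-mono : ∀ b c (bs cs : List Bool) → length bs ≡ length cs →
  fromBits (b ∷ bs) ≤ fromBits (c ∷ cs) → b ≡ true → c ≡ true
leadingBit-mono _    true  _  _  _    _  _    = refl
leadingBit-mono true false bs cs same le refl = ⊥-elim (<⇒≱ (fromBits-0∷<1∷ bs cs same) le)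

UpClosed : ∀ {k} → (Fin k → Bool) → Set
UpClosed {k} f = ∀ (a b : Fin k) → toℕ a ≤ toℕ b → f a ≡ true → f b ≡ true

leadingBits-upClosed : ∀ {k l} (v : Fin k → Fin (suc l) → Bool) →
  NonDecreasing (λ a → fromBits (toList (v a))) → UpClosed (λ a → v a zero)
leadingBits-upClosed {l = l} v nonDecreasing a b a≤b =
  leadingBit-mono (v a zero) (v b zero) (tail a) (tail b)
    (trans (length-tabulate {n = l} (λ i → v a (suc i))) (sym (length-tabulate (λ i → v b (suc i)))))
    (nonDecreasing a b a≤b)
  where
  tail : Fin _ → List Bool
  tail a = toList (λ i → v a (suc i))

IsThreshold : ∀ {k} → (Fin k → Bool) → ℕ → Set
IsThreshold f j = ∀ x → (toℕ x < j → f x ≡ false) × (j ≤ toℕ x → f x ≡ true)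

upClosed⇒threshold : ∀ k (f : Fin k → Bool) → UpClosed f → Σ ℕ (λ j → j ≤ k × IsThreshold f j)
upClosed⇒threshold zero    f upClosed = 0 , z≤n , λ ()
upClosed⇒threshold (suc k) f upClosed with f zero in f0
... | true  = 0 , z≤n , λ x → (λ ()) , (λ _ → upClosed zero x z≤n f0)
... | false with upClosed⇒threshold k (λ y → f (suc y)) (λ a b a≤b → upClosed (suc a) (suc b) (s≤s a≤b))
...   | j , j≤k , threshold = suc j , s≤s j≤k , shifted
  where
  shifted : IsThreshold f (suc j)
  shifted zero    = (λ _ → f0) , (λ ())
  shifted (suc y) = (λ { (s≤s y<j) → proj₁ (threshold y) y<j })
                  , (λ { (s≤s j≤y) → proj₂ (threshold y) j≤y })

proposition1 : (n m : ℕ) → (A : BinMatrix (suc n) (suc m)) → SemiCanonical A →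
    Σ ℕ (λ i → Σ ℕ (λ j →
      i ≤ suc n × j ≤ suc m ×
      (∀ (k : Fin (suc m)) → (toℕ k < j → A zero k ≡ false) × (j ≤ toℕ k → A zero k ≡ true)) ×
      (∀ (k : Fin (suc n)) → (toℕ k < i → A k zero ≡ false) × (i ≤ toℕ k → A k zero ≡ true))))
proposition1 n m A (rowsSorted , colsSorted)
  with upClosed⇒threshold (suc m) (A zero) (leadingBits-upClosed (λ j i → A i j) colsSorted)
     | upClosed⇒threshold (suc n) (λ i → A i zero) (leadingBits-upClosed A rowsSorted)
... | j , j≤m+1 , firstRow | i , i≤n+1 , firstColumn = i , j , i≤n+1 , j≤m+1 , firstRow , firstColumn
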